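{- Let $A>2$ be a positive integer, let $n\ge3$, and let $\mathbf P(A)=(P_{ij})_{0\le i,j\le n-1}$ be the $n\times n$ transition probability matrix with entries $P_{00}=1-\frac1A,\ P_{01}=\frac1A$; $P_{10}=1-\frac1A,\ P_{12}=\frac1A$; for $2\le i\le n-2$: $P_{i0}=1-\frac2A,\ P_{i,i-1}=P_{i,i+1}=\frac1A$; $P_{n-1,0}=1-\frac1A,\ P_{n-1,n-2}=\frac1A$; and all other entries $0$. Then the steady state probability vector $\vec\pi=(\pi_0,\dots,\pi_{n-1})$ of $\mathbf P(A)$ is given by $$\pi_i=\frac{x_{n-i}}{\sum_{j=1}^{n}x_j},\qquad i=0,1,\dots,n-1.$$
   Context: For the fixed integer $A>2$, the balancing-like sequence $(x_m)$ is defined by $x_0=0$, $x_1=1$, $x_{m+1}=Ax_m-x_{m-1}$. The steady state probability vector of a transition probability matrix $\mathbf P$ is the probability row vector $\vec\pi$ (nonnegative entries summing to $1$) satisfying $\vec\pi=\vec\pi\mathbf P$. -}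

module Defs where

open import Data.Nat as ℕ using (ℕ; zero; suc; _≡ᵇ_; _∸_)
open import Data.Integer as ℤ using (ℤ; +_; +[1+_]; -[1+_])
open import Data.Rational using (ℚ; mkℚ; 0ℚ; 1ℚ; _+_; _*_; _-_; _÷_)
import Data.Rational as Q
open import Data.Fin using (Fin; toℕ)
open import Data.Bool using (if_then_else_; _∨_)

-- Division on ℚ with the (irrelevant here) convention p / 0 = 0.
infixl 7 _/ℚ_
_/ℚ_ : ℚ → ℚ → ℚ
p /ℚ mkℚ (+ zero) _ _ = 0ℚ
p /ℚ q@(mkℚ +[1+ _ ] _ _) = p ÷ q
p /ℚ q@(mkℚ -[1+ _ ] _ _) = p ÷ q

sumFin : (n : ℕ) → (Fin n → ℚ) → ℚ
sumFin zero f = 0ℚ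
sumFin (suc n) f = f Fin.zero + sumFin n (λ i → f (Fin.suc i))
  where import Data.Fin as Fin

x : ℕ → ℕ → ℤ
x A zero = + 0
x A (suc zero) = + 1
x A (suc (suc m)) = (+ A) ℤ.* x A (suc m) ℤ.- x A m

sumX : ℕ → ℕ → ℤ
sumX A zero = + 0
sumX A (suc n) = sumX A n ℤ.+ x A (suc n)

invA : ℕ → ℚ
invA A = 1ℚ /ℚ Q._/_ (+ A) 1

Pℕ : (A n i j : ℕ) → ℚ
Pℕ A n zero j =
  if j ≡ᵇ 0 then 1ℚ - invA A else if j ≡ᵇ 1 then invA A else 0ℚ
Pℕ A n (suc zero) j =
  if j ≡ᵇ 0 then 1ℚ - invA A else if j ≡ᵇ 2 then invA A else 0ℚ
Pℕ A n i@(suc (suc k)) j =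
  if i ≡ᵇ (n ∸ 1)
  then (if j ≡ᵇ 0 then 1ℚ - invA A else if j ≡ᵇ (n ∸ 2) then invA A else 0ℚ)
  else (if j ≡ᵇ 0 then 1ℚ - (invA A + invA A)
        else if (j ≡ᵇ suc k) ∨ (j ≡ᵇ suc (suc (suc k))) then invA A else 0ℚ)

P : (A n : ℕ) → Fin n → Fin n → ℚ
P A n i j = Pℕ A n (toℕ i) (toℕ j)

IsSteadyState : (n : ℕ) → (Fin n → Fin n → ℚ) → (Fin n → ℚ) → Set
IsSteadyState n M π =
  ((i : Fin n) → 0ℚ Q.≤ π i)
  × (sumFin n π ≡ 1ℚ)
  × ((j : Fin n) → π j ≡ sumFin n (λ i → π i * M i j))
  where
    open import Data.Product using (_×_)
    open import Relation.Binary.PropositionalEquality using (_≡_)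

πformula : (A n : ℕ) → Fin n → ℚ
πformula A n i = Q._/_ (x A (n ∸ toℕ i)) 1 /ℚ Q._/_ (sumX A n) 1

-- Put w k = π (n - k), with π n = 0. The balance equations at the states 1, …, n-1
-- say exactly that w k + w (k+2) = A · w (k+1) for k + 2 ≤ n: this is the recurrence of
-- the balancing-like sequence, and w 0 = 0, so w = w 1 · x. The balance equation at
-- state 0 is then automatic because P is row-stochastic. Normalising forces
-- w 1 = 1 / ∑ x_j, and since x is nonnegative and increasing for A ≥ 2 this vector is
-- indeed a probability vector.
module Submission where

open import Defs
open import Data.Nat as ℕ using (ℕ; zero; suc; _≡ᵇ_; _∸_; _<_; _≤_; s≤s; z≤n; z<s)
import Data.Nat.Properties as ℕP
open import Data.Integer as ℤ using (+_; +[1+_]; -[1+_]; 0ℤ)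
import Data.Integer.Properties as ℤP
open import Data.Integer.Solver using (module +-*-Solver)
open import Data.Rational as Q using (ℚ; mkℚ; 0ℚ; 1ℚ; _+_; _*_; _-_; _÷_; 1/_)
open import Data.Rational.Literals using (fromℤ)
import Data.Rational.Properties as QP
open import Algebra.Bundles using (Ring)
open import Algebra.Properties.Semiring.Sum (Ring.semiring QP.+-*-ring)
  using (sum; sum-cong-≗; sum-replicate-zero; ∑-comm; *-distribˡ-sum; *-distribʳ-sum)
open import Algebra.Properties.Group QP.+-0-group using (∙-cancelˡ; ∙-cancelʳ; //-rightDividesˡ)
open import Data.Fin as Fin using (Fin; toℕ)
import Data.Fin.Properties as FP
open import Data.Bool using (true; false)
open import Data.Bool.Properties using (∨-zeroʳ)
open import Data.Empty using (⊥-elim)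
open import Data.Product using (_×_; _,_; proj₁; proj₂)
open import Data.Sum using (inj₁; inj₂)
open import Function using (_∘_; _⇔_; mk⇔; Equivalence)
open import Relation.Nullary using (yes; no)
open import Relation.Nullary.Decidable using (dec-true; dec-false)
open import Relation.Binary.PropositionalEquality

/ℚ≡÷ : ∀ p q .{{_ : Q.NonZero q}} → p /ℚ q ≡ p ÷ q
/ℚ≡÷ p (mkℚ +[1+ _ ] _ _) = refl
/ℚ≡÷ p (mkℚ -[1+ _ ] _ _) = refl

/1≡fromℤ : ∀ z → z Q./ 1 ≡ fromℤ z
/1≡fromℤ z = QP.↥p/↧p≡p (fromℤ z)

/ℚ-fromℤ : ∀ p z .{{_ : ℤ.NonZero z}} → p /ℚ (z Q./ 1) ≡ p * 1/ fromℤ z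
/ℚ-fromℤ p z = trans (cong (p /ℚ_) (/1≡fromℤ z)) (/ℚ≡÷ p (fromℤ z))

fromℤ-+ : ∀ a b → fromℤ (a ℤ.+ b) ≡ fromℤ a + fromℤ b
fromℤ-+ a b = sym (trans (QP./-cong (cong₂ ℤ._+_ (ℤP.*-identityʳ a) (ℤP.*-identityʳ b)) refl) (/1≡fromℤ _))

fromℤ-* : ∀ a b → fromℤ (a ℤ.* b) ≡ fromℤ a * fromℤ b
fromℤ-* a b = sym (/1≡fromℤ _)

transpose-by-inverse : ∀ {a b} → b * a ≡ 1ℚ → ∀ {c s} → (c ≡ s * b) ⇔ (s ≡ a * c)
transpose-by-inverse {a} {b} ba≡1 {c} {s} = mk⇔
  (λ c≡sb → begin
    s               ≡⟨ QP.*-identityʳ s ⟨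
    s * 1ℚ          ≡⟨ cong (s *_) ba≡1 ⟨
    s * (b * a)     ≡⟨ QP.*-assoc s b a ⟨
    s * b * a       ≡⟨ cong (_* a) c≡sb ⟨
    c * a           ≡⟨ QP.*-comm c a ⟩
    a * c           ∎)
  (λ s≡ac → begin
    c               ≡⟨ QP.*-identityˡ c ⟨
    1ℚ * c          ≡⟨ cong (_* c) ba≡1 ⟨
    b * a * c       ≡⟨ QP.*-assoc b a c ⟩
    b * (a * c)     ≡⟨ cong (b *_) s≡ac ⟨
    b * s           ≡⟨ QP.*-comm b s ⟩
    s * b           ∎)
  where open ≡-Reasoning

invA-inverse : ∀ A .{{_ : ℕ.NonZero A}} → invA A * fromℤ (+ A) ≡ 1ℚ
invA-inverse A = begin
  invA A * fromℤ (+ A)                 ≡⟨ cong (_* fromℤ (+ A)) (/ℚ-fromℤ 1ℚ (+ A)) ⟩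
  1ℚ * 1/ fromℤ (+ A) * fromℤ (+ A)    ≡⟨ cong (_* fromℤ (+ A)) (QP.*-identityˡ (1/ fromℤ (+ A))) ⟩
  1/ fromℤ (+ A) * fromℤ (+ A)         ≡⟨ QP.*-inverseˡ (fromℤ (+ A)) ⟩
  1ℚ                                   ∎
  where open ≡-Reasoning

sumFin≡sum : ∀ n (f : Fin n → ℚ) → sumFin n f ≡ sum f
sumFin≡sum zero    f = refl
sumFin≡sum (suc n) f = cong (_+_ (f Fin.zero)) (sumFin≡sum n (f ∘ Fin.suc))

sumFin-cong : ∀ n {f g : Fin n → ℚ} → (∀ i → f i ≡ g i) → sumFin n f ≡ sumFin n g
sumFin-cong n {f} {g} f≗g = trans (sumFin≡sum n f) (trans (sum-cong-≗ f≗g) (sym (sumFin≡sum n g)))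

sumFin-*ʳ : ∀ n (f : Fin n → ℚ) c → sumFin n (λ i → f i * c) ≡ sumFin n f * c
sumFin-*ʳ n f c =
  trans (sumFin≡sum n _) (trans (sym (*-distribʳ-sum c f)) (cong (_* c) (sym (sumFin≡sum n f))))

sumFin-single : ∀ n (f : ℕ → ℚ) {a} → a < n → (∀ i → i < n → i ≢ a → f i ≡ 0ℚ) →
  sumFin n (λ i → f (toℕ i)) ≡ f a
sumFin-single (suc n) f {zero} _ f≡0 =
  trans (cong (_+_ (f 0)) (trans (sumFin-cong n (λ i → f≡0 (suc (toℕ i)) (s≤s (FP.toℕ<n i)) λ ()))
                                 (trans (sumFin≡sum n _) (sum-replicate-zero n))))
        (QP.+-identityʳ (f 0))
sumFin-single (suc n) f {suc a} (s≤s a<n) f≡0 =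
  trans (cong₂ _+_ (f≡0 0 z<s λ ())
                   (sumFin-single n (f ∘ suc) a<n
                     (λ i i<n i≢a → f≡0 (suc i) (s≤s i<n) (i≢a ∘ ℕP.suc-injective))))
        (QP.+-identityˡ (f (suc a)))

sumFin-pair : ∀ n (f : ℕ → ℚ) {a b} → a < b → b < n → (∀ i → i < n → i ≢ a → i ≢ b → f i ≡ 0ℚ) →
  sumFin n (λ i → f (toℕ i)) ≡ f a + f b
sumFin-pair (suc n) f {zero} {suc b} _ (s≤s b<n) f≡0 =
  cong (_+_ (f 0)) (sumFin-single n (f ∘ suc) b<n
                     (λ i i<n i≢b → f≡0 (suc i) (s≤s i<n) (λ ()) (i≢b ∘ ℕP.suc-injective)))
sumFin-pair (suc n) f {suc a} {suc b} (s≤s a<b) (s≤s b<n) f≡0 =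
  trans (cong₂ _+_ (f≡0 0 z<s (λ ()) (λ ()))
                   (sumFin-pair n (f ∘ suc) a<b b<n
                     (λ i i<n i≢a i≢b →
                        f≡0 (suc i) (s≤s i<n) (i≢a ∘ ℕP.suc-injective) (i≢b ∘ ℕP.suc-injective))))
        (QP.+-identityˡ _)

vecMat : ∀ {n} → (Fin n → ℚ) → (Fin n → Fin n → ℚ) → Fin n → ℚ
vecMat {n} π M j = sumFin n (λ i → π i * M i j)

vecMatℕ : ℕ → (ℕ → ℚ) → (ℕ → ℕ → ℚ) → ℕ → ℚ
vecMatℕ n v M j = sumFin n (λ i → v (toℕ i) * M (toℕ i) j)

RowStochastic : ∀ n → (Fin n → Fin n → ℚ) → Set
RowStochastic n M = ∀ i → sumFin n (M i) ≡ 1ℚ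

sumFin-vecMat : ∀ n M → RowStochastic n M → (π : Fin n → ℚ) → sumFin n (vecMat π M) ≡ sumFin n π
sumFin-vecMat n M stochastic π = begin
  sumFin n (vecMat π M)                      ≡⟨ sumFin-cong n (λ j → sumFin≡sum n _) ⟩
  sumFin n (λ j → sum (λ i → π i * M i j))   ≡⟨ sumFin≡sum n _ ⟩
  sum (λ j → sum (λ i → π i * M i j))        ≡⟨ ∑-comm (λ i j → π i * M i j) ⟨
  sum (λ i → sum (λ j → π i * M i j))        ≡⟨ sum-cong-≗ (λ i → *-distribˡ-sum (π i) (M i)) ⟨
  sum (λ i → π i * sum (M i))                ≡⟨ sum-cong-≗ (λ i → cong (π i *_) rowSum≡1) ⟩
  sum (λ i → π i * 1ℚ)                       ≡⟨ sum-cong-≗ (QP.*-identityʳ ∘ π) ⟩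
  sum π                                      ≡⟨ sumFin≡sum n π ⟨
  sumFin n π                                 ∎
  where
  open ≡-Reasoning
  rowSum≡1 : ∀ {i} → sum (M i) ≡ 1ℚ
  rowSum≡1 {i} = trans (sym (sumFin≡sum n (M i))) (stochastic i)

balance-from-suc : ∀ n M → RowStochastic (suc n) M → (π : Fin (suc n) → ℚ) →
  (∀ j → π (Fin.suc j) ≡ vecMat π M (Fin.suc j)) → ∀ j → π j ≡ vecMat π M j
balance-from-suc n M stochastic π balance-suc Fin.zero = ∙-cancelʳ (sumFin n (π ∘ Fin.suc)) _ _ (begin
  π Fin.zero + sumFin n (π ∘ Fin.suc)          ≡⟨ sumFin-vecMat (suc n) M stochastic π ⟨
  πM Fin.zero + sumFin n (πM ∘ Fin.suc)        ≡⟨ cong (_+_ (πM Fin.zero)) (sumFin-cong n balance-suc) ⟨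
  πM Fin.zero + sumFin n (π ∘ Fin.suc)         ∎)
  where
  open ≡-Reasoning
  πM = vecMat π M
balance-from-suc n M stochastic π balance-suc (Fin.suc j) = balance-suc j

IsSteadyState-resp : ∀ {n} M {π π′} → (∀ i → π i ≡ π′ i) → IsSteadyState n M π → IsSteadyState n M π′
IsSteadyState-resp {n} M π≗π′ (nonNeg , sum≡1 , balance) =
  (λ i → subst (0ℚ Q.≤_) (π≗π′ i) (nonNeg i)) ,
  trans (sumFin-cong n (sym ∘ π≗π′)) sum≡1 ,
  λ j → trans (sym (π≗π′ j)) (trans (balance j) (sumFin-cong n (λ i → cong (_* M i j) (π≗π′ i))))

extend : ∀ {n} → (Fin n → ℚ) → ℕ → ℚ
extend {n} π k with k ℕP.<? n
... | yes k<n = π (Fin.fromℕ< k<n)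
... | no _    = 0ℚ

extend-toℕ : ∀ {n} (π : Fin n → ℚ) i → extend π (toℕ i) ≡ π i
extend-toℕ {n} π i with toℕ i ℕP.<? n
... | yes i<n = cong π (FP.fromℕ<-toℕ i i<n)
... | no i≮n  = ⊥-elim (i≮n (FP.toℕ<n i))

extend-outside : ∀ {n} (π : Fin n → ℚ) → extend π n ≡ 0ℚ
extend-outside {n} π with n ℕP.<? n
... | yes n<n = ⊥-elim (ℕP.<-irrefl refl n<n)
... | no _    = refl

extend-balance : ∀ {n} (M : ℕ → ℕ → ℚ) (π : Fin n → ℚ) →
  (∀ j → π j ≡ vecMat π (λ i j → M (toℕ i) (toℕ j)) j) →
  ∀ j → j < n → extend π j ≡ vecMatℕ n (extend π) M j
extend-balance {n} M π balance j j<n =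
  subst (λ k → extend π k ≡ vecMatℕ n (extend π) M k) (FP.toℕ-fromℕ< j<n) (at (Fin.fromℕ< j<n))
  where
  at : ∀ f → extend π (toℕ f) ≡ vecMatℕ n (extend π) M (toℕ f)
  at f = trans (extend-toℕ π f)
        (trans (balance f) (sumFin-cong n (λ i → cong (_* M (toℕ i) (toℕ f)) (sym (extend-toℕ π i)))))

x-recurrence : ∀ A k → x A k ℤ.+ x A (suc (suc k)) ≡ + A ℤ.* x A (suc k)
x-recurrence A k = solve 3 (λ u v a → u :+ (a :* v :- u) := a :* v) refl (x A k) (x A (suc k)) (+ A)
  where open +-*-Solver

x-nonNeg-mono : ∀ {A} → 2 ≤ A → ∀ k → 0ℤ ℤ.≤ x A k × x A k ℤ.≤ x A (suc k)
x-nonNeg-mono 2≤A zero = ℤ.+≤+ z≤n , ℤ.+≤+ z≤n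
x-nonNeg-mono {A} 2≤A (suc k) with x-nonNeg-mono 2≤A k
... | 0≤u , u≤v = 0≤v , (begin
  v                  ≡⟨ solve 1 (λ v → v := con (+ 2) :* v :- v) refl v ⟩
  + 2 ℤ.* v ℤ.- v    ≤⟨ ℤP.+-mono-≤ (ℤP.*-monoʳ-≤-nonNeg v {{ℤ.nonNegative 0≤v}} (ℤ.+≤+ 2≤A))
                                   (ℤP.neg-mono-≤ u≤v) ⟩
  + A ℤ.* v ℤ.- u    ∎)
  where
  u = x A k
  v = x A (suc k)
  0≤v = ℤP.≤-trans 0≤u u≤v
  open ℤP.≤-Reasoning
  open +-*-Solver

x-suc-pos : ∀ {A} → 2 ≤ A → ∀ k → 0ℤ ℤ.< x A (suc k)
x-suc-pos _   zero    = ℤ.+<+ z<s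
x-suc-pos 2≤A (suc k) = ℤP.<-≤-trans (x-suc-pos 2≤A k) (proj₂ (x-nonNeg-mono 2≤A (suc k)))

sumX-nonNeg : ∀ {A} → 2 ≤ A → ∀ n → 0ℤ ℤ.≤ sumX A n
sumX-pos : ∀ {A} → 2 ≤ A → ∀ n → 0ℤ ℤ.< sumX A (suc n)

sumX-nonNeg _   zero    = ℤP.≤-refl
sumX-nonNeg 2≤A (suc n) = ℤP.<⇒≤ (sumX-pos 2≤A n)

sumX-pos 2≤A n = ℤP.+-mono-≤-< (sumX-nonNeg 2≤A n) (x-suc-pos 2≤A n)

xℚ : ℕ → ℕ → ℚ
xℚ A k = fromℤ (x A k)

xℚ-nonNeg : ∀ {A} → 2 ≤ A → ∀ k → Q.NonNegative (xℚ A k)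
xℚ-nonNeg 2≤A k = ℤ.nonNegative (proj₁ (x-nonNeg-mono 2≤A k))

sumFin-xℚ-reversed : ∀ A n c → sumFin n (λ i → xℚ A (n ∸ toℕ i) * c) ≡ fromℤ (sumX A n) * c
sumFin-xℚ-reversed A n c = trans (sumFin-*ʳ n _ c) (cong (_* c) (unscaled n))
  where
  unscaled : ∀ n → sumFin n (λ i → xℚ A (n ∸ toℕ i)) ≡ fromℤ (sumX A n)
  unscaled zero    = refl
  unscaled (suc n) = begin
    xℚ A (suc n) + sumFin n (λ i → xℚ A (n ∸ toℕ i))  ≡⟨ cong (_+_ (xℚ A (suc n))) (unscaled n) ⟩
    xℚ A (suc n) + fromℤ (sumX A n)                    ≡⟨ QP.+-comm (xℚ A (suc n)) (fromℤ (sumX A n)) ⟩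
    fromℤ (sumX A n) + xℚ A (suc n)                    ≡⟨ fromℤ-+ (sumX A n) (x A (suc n)) ⟨
    fromℤ (sumX A (suc n))                             ∎
    where open ≡-Reasoning

-- Written symmetrically in w k and w (k+2), so that it is invariant under reversal.
record Recurrence (a : ℚ) (n : ℕ) (w : ℕ → ℚ) : Set where
  field
    step : ∀ k → suc (suc k) ≤ n → w k + w (suc (suc k)) ≡ a * w (suc k)
open Recurrence

xℚ-recurrence : ∀ A n → Recurrence (fromℤ (+ A)) n (xℚ A)
step (xℚ-recurrence A n) k _ = begin
  xℚ A k + xℚ A (suc (suc k))            ≡⟨ fromℤ-+ (x A k) _ ⟨
  fromℤ (x A k ℤ.+ x A (suc (suc k)))    ≡⟨ cong fromℤ (x-recurrence A k) ⟩
  fromℤ (+ A ℤ.* x A (suc k))            ≡⟨ fromℤ-* (+ A) _ ⟩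
  fromℤ (+ A) * xℚ A (suc k)             ∎
  where open ≡-Reasoning

Recurrence-scale : ∀ {a n w} → Recurrence a n w → ∀ c → Recurrence a n (λ k → w k * c)
step (Recurrence-scale {a} {n} {w} rec c) k k+2≤n = begin
  w k * c + w (suc (suc k)) * c    ≡⟨ QP.*-distribʳ-+ c (w k) _ ⟨
  (w k + w (suc (suc k))) * c      ≡⟨ cong (_* c) (step rec k k+2≤n) ⟩
  a * w (suc k) * c                ≡⟨ QP.*-assoc a _ c ⟩
  a * (w (suc k) * c)              ∎
  where open ≡-Reasoning

∸-suc : ∀ {m n} → n < m → m ∸ n ≡ suc (m ∸ suc n)
∸-suc {suc m} (s≤s n≤m) = ℕP.+-∸-assoc 1 n≤m

Recurrence-reverse : ∀ {a n w} → Recurrence a n w → Recurrence a n (λ k → w (n ∸ k))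
step (Recurrence-reverse {a} {n} {w} rec) k k+2≤n = begin
  w (n ∸ k) + w j          ≡⟨ cong (λ i → w i + w j) n∸k≡j+2 ⟩
  w (suc (suc j)) + w j    ≡⟨ QP.+-comm _ (w j) ⟩
  w j + w (suc (suc j))    ≡⟨ step rec j (subst (_≤ n) n∸k≡j+2 (ℕP.m∸n≤m n k)) ⟩
  a * w (suc j)            ≡⟨ cong (λ i → a * w i) n∸[k+1]≡j+1 ⟨
  a * w (n ∸ suc k)        ∎
  where
  open ≡-Reasoning
  j = n ∸ suc (suc k)
  n∸[k+1]≡j+1 : n ∸ suc k ≡ suc j
  n∸[k+1]≡j+1 = ∸-suc k+2≤n
  n∸k≡j+2 : n ∸ k ≡ suc (suc j)
  n∸k≡j+2 = trans (∸-suc (ℕP.<⇒≤ k+2≤n)) (cong suc n∸[k+1]≡j+1)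

Recurrence-unique : ∀ {A n w} → Recurrence (fromℤ (+ A)) n w → w 0 ≡ 0ℚ →
  ∀ k → k ≤ n → w k ≡ xℚ A k * w 1
Recurrence-unique {A} {n} {w} rec w₀≡0 zero    _   = trans w₀≡0 (sym (QP.*-zeroˡ (w 1)))
Recurrence-unique {A} {n} {w} rec w₀≡0 (suc k) k<n = proj₂ (consecutive k k<n)
  where
  open ≡-Reasoning
  consecutive : ∀ k → suc k ≤ n → w k ≡ xℚ A k * w 1 × w (suc k) ≡ xℚ A (suc k) * w 1
  consecutive zero _ = trans w₀≡0 (sym (QP.*-zeroˡ (w 1))) , sym (QP.*-identityˡ (w 1))
  consecutive (suc k) k+2≤n with consecutive k (ℕP.<⇒≤ k+2≤n)
  ... | wₖ , wₖ₊₁ = wₖ₊₁ , ∙-cancelˡ (w k) _ _ (begin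
    w k + w (suc (suc k))                      ≡⟨ step rec k k+2≤n ⟩
    fromℤ (+ A) * w (suc k)                    ≡⟨ cong (fromℤ (+ A) *_) wₖ₊₁ ⟩
    fromℤ (+ A) * (xℚ A (suc k) * w 1)         ≡⟨ QP.*-assoc (fromℤ (+ A)) (xℚ A (suc k)) (w 1) ⟨
    fromℤ (+ A) * xℚ A (suc k) * w 1           ≡⟨ cong (_* w 1) (step (xℚ-recurrence A n) k k+2≤n) ⟨
    (xℚ A k + xℚ A (suc (suc k))) * w 1        ≡⟨ QP.*-distribʳ-+ (w 1) (xℚ A k) (xℚ A (suc (suc k))) ⟩
    xℚ A k * w 1 + xℚ A (suc (suc k)) * w 1    ≡⟨ cong (_+ xℚ A (suc (suc k)) * w 1) wₖ ⟨
    w k + xℚ A (suc (suc k)) * w 1             ∎)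

≡ᵇ-refl : ∀ n → (n ≡ᵇ n) ≡ true
≡ᵇ-refl n = dec-true (n ℕP.≟ n) refl

≢⇒≡ᵇ-false : ∀ {m n} → m ≢ n → (m ≡ᵇ n) ≡ false
≢⇒≡ᵇ-false {m} {n} = dec-false (m ℕP.≟ n)

module _ (A m : ℕ) where

  private
    n : ℕ
    n = 3 ℕ.+ m

  P-up : ∀ i → suc i < n → Pℕ A n i (suc i) ≡ invA A
  P-up zero          _ = refl
  P-up (suc zero)    _ = refl
  P-up (suc (suc k)) (s≤s (s≤s (s≤s k<m)))
    rewrite ≢⇒≡ᵇ-false (ℕP.<⇒≢ k<m) | ≡ᵇ-refl k | ∨-zeroʳ (suc (suc k) ≡ᵇ k) = refl

  P-down : ∀ j → Pℕ A n (suc (suc j)) (suc j) ≡ invA A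
  P-down j with j ℕP.≟ m
  ... | yes refl rewrite ≡ᵇ-refl j = refl
  ... | no j≢m   rewrite ≢⇒≡ᵇ-false j≢m | ≡ᵇ-refl j = refl

  P-off : ∀ i j → i ≢ j → i ≢ suc (suc j) → Pℕ A n i (suc j) ≡ 0ℚ
  P-off zero          j i≢j _ rewrite ≢⇒≡ᵇ-false (i≢j ∘ sym) = refl
  P-off (suc zero)    j i≢j _ rewrite ≢⇒≡ᵇ-false (i≢j ∘ sym) = refl
  P-off (suc (suc k)) j i≢j i≢j+2 with k ℕP.≟ m
  ... | yes refl rewrite ≡ᵇ-refl k | ≢⇒≡ᵇ-false (i≢j+2 ∘ cong (suc ∘ suc) ∘ sym) = refl
  ... | no k≢m   rewrite ≢⇒≡ᵇ-false k≢m | ≢⇒≡ᵇ-false (i≢j+2 ∘ cong (suc ∘ suc) ∘ sym)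
                       | ≢⇒≡ᵇ-false (i≢j ∘ sym) = refl

  P-last-first : Pℕ A n (2 ℕ.+ m) 0 ≡ 1ℚ - invA A
  P-last-first rewrite ≡ᵇ-refl m = refl

  P-inner-first : ∀ k → k ≢ m → Pℕ A n (2 ℕ.+ k) 0 ≡ 1ℚ - (invA A + invA A)
  P-inner-first k k≢m rewrite ≢⇒≡ᵇ-false k≢m = refl

  P-first-column : ∀ i → i < n → Pℕ A n i 0 ≡ 1ℚ - sumFin (2 ℕ.+ m) (λ j → Pℕ A n i (suc (toℕ j)))
  P-first-column zero _ =
    cong (1ℚ -_) (sym (sumFin-single (2 ℕ.+ m) (λ j → Pℕ A n 0 (suc j)) z<s
                         (λ j _ j≢0 → P-off 0 j (j≢0 ∘ sym) λ ())))
  P-first-column (suc zero) _ =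
    cong (1ℚ -_) (sym (sumFin-single (2 ℕ.+ m) (λ j → Pℕ A n 1 (suc j)) (s≤s z<s)
                         (λ j _ j≢1 → P-off 1 j (j≢1 ∘ sym) λ ())))
  P-first-column (suc (suc k)) (s≤s (s≤s (s≤s k≤m))) with k ℕP.≟ m
  ... | yes refl = trans P-last-first (cong (1ℚ -_) (sym (trans
    (sumFin-single (2 ℕ.+ k) (λ j → Pℕ A n (2 ℕ.+ k) (suc j)) (ℕP.m<n+m k {2} z<s)
      (λ j j<k+2 j≢k → P-off (2 ℕ.+ k) j (λ e → ℕP.<-irrefl (sym e) j<k+2)
                               (j≢k ∘ ℕP.suc-injective ∘ ℕP.suc-injective ∘ sym)))
    (P-down k))))
  ... | no k≢m = trans (P-inner-first k k≢m) (cong (1ℚ -_) (sym (trans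
    (sumFin-pair (2 ℕ.+ m) (λ j → Pℕ A n (2 ℕ.+ k) (suc j)) (ℕP.m<n+m k {2} z<s) (s≤s (s≤s k<m))
      (λ j _ j≢k j≢k+2 → P-off (2 ℕ.+ k) j (j≢k+2 ∘ sym)
                                   (j≢k ∘ ℕP.suc-injective ∘ ℕP.suc-injective ∘ sym)))
    (cong₂ _+_ (P-down k) (P-up (2 ℕ.+ k) (s≤s (s≤s (s≤s k<m))))))))
    where k<m = ℕP.≤∧≢⇒< k≤m k≢m

  P-rowStochastic : RowStochastic n (P A n)
  P-rowStochastic i =
    trans (cong (_+ rest) (P-first-column (toℕ i) (FP.toℕ<n i))) (//-rightDividesˡ rest 1ℚ)
    where rest = sumFin (2 ℕ.+ m) (λ j → Pℕ A n (toℕ i) (suc (toℕ j)))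

  P-off-weighted : ∀ (v : ℕ → ℚ) i j → i ≢ j → i ≢ suc (suc j) → v i * Pℕ A n i (suc j) ≡ 0ℚ
  P-off-weighted v i j i≢j i≢j+2 = trans (cong (v i *_) (P-off i j i≢j i≢j+2)) (QP.*-zeroʳ (v i))

  -- With v n = 0 the last column has the same shape as the interior ones.
  vecMatℕ-P-suc : ∀ v → v n ≡ 0ℚ → ∀ j → suc (suc j) ≤ n →
    vecMatℕ n v (Pℕ A n) (suc j) ≡ (v j + v (suc (suc j))) * invA A
  vecMatℕ-P-suc v vₙ≡0 j j+2≤n with ℕP.m≤n⇒m<n∨m≡n j+2≤n
  ... | inj₁ j+2<n = begin
    vecMatℕ n v (Pℕ A n) (suc j)
      ≡⟨ sumFin-pair n (λ i → v i * Pℕ A n i (suc j)) (ℕP.m<n+m j {2} z<s) j+2<n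
                     (λ i _ → P-off-weighted v i j) ⟩
    v j * Pℕ A n j (suc j) + v (suc (suc j)) * Pℕ A n (suc (suc j)) (suc j)
      ≡⟨ cong₂ _+_ (cong (v j *_) (P-up j (ℕP.<-trans (ℕP.n<1+n _) j+2<n)))
                   (cong (v (suc (suc j)) *_) (P-down j)) ⟩
    v j * invA A + v (suc (suc j)) * invA A
      ≡⟨ QP.*-distribʳ-+ (invA A) (v j) _ ⟨
    (v j + v (suc (suc j))) * invA A ∎
    where open ≡-Reasoning
  ... | inj₂ refl = begin
    vecMatℕ n v (Pℕ A n) (2 ℕ.+ m)
      ≡⟨ sumFin-single n (λ i → v i * Pℕ A n i (2 ℕ.+ m)) (ℕP.m<n+m (suc m) {2} z<s)
                       (λ i i<n i≢j → P-off-weighted v i (suc m) i≢j (λ e → ℕP.<-irrefl e i<n)) ⟩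
    v (suc m) * Pℕ A n (suc m) (2 ℕ.+ m)   ≡⟨ cong (v (suc m) *_) (P-up (suc m) ℕP.≤-refl) ⟩
    v (suc m) * invA A                      ≡⟨ cong (_* invA A) (QP.+-identityʳ (v (suc m))) ⟨
    (v (suc m) + 0ℚ) * invA A               ≡⟨ cong (λ t → (v (suc m) + t) * invA A) vₙ≡0 ⟨
    (v (suc m) + v n) * invA A              ∎
    where open ≡-Reasoning

  interior-balance⇔Recurrence : .{{_ : ℕ.NonZero A}} → ∀ v → v n ≡ 0ℚ →
    (∀ j → suc (suc j) ≤ n → v (suc j) ≡ vecMatℕ n v (Pℕ A n) (suc j)) ⇔ Recurrence (fromℤ (+ A)) n v
  interior-balance⇔Recurrence v vₙ≡0 = mk⇔
    (λ balance → record { step = λ j j+2≤n →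
      Equivalence.to transpose (trans (balance j j+2≤n) (vecMatℕ-P-suc v vₙ≡0 j j+2≤n)) })
    (λ rec j j+2≤n →
      trans (Equivalence.from transpose (step rec j j+2≤n)) (sym (vecMatℕ-P-suc v vₙ≡0 j j+2≤n)))
    where transpose = transpose-by-inverse {fromℤ (+ A)} {invA A} (invA-inverse A)

module _ (A m : ℕ) (2≤A : 2 ≤ A) where

  private
    n : ℕ
    n = 3 ℕ.+ m

    instance
      A-nonZero : ℕ.NonZero A
      A-nonZero = ℕ.>-nonZero (ℕP.<-≤-trans z<s 2≤A)

      sumX-nonZero : ℤ.NonZero (sumX A n)
      sumX-nonZero = ℤ.>-nonZero (sumX-pos 2≤A (2 ℕ.+ m))

  normaliser : ℚ
  normaliser = 1/ fromℤ (sumX A n)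

  normaliser-pos : Q.Positive normaliser
  normaliser-pos = QP.1/pos⇒pos (fromℤ (sumX A n)) {{ℤ.positive (sumX-pos 2≤A (2 ℕ.+ m))}}

  stationary : ℕ → ℚ
  stationary i = xℚ A (n ∸ i) * normaliser

  stationary-balance-suc : ∀ j → suc (suc j) ≤ n → stationary (suc j) ≡ vecMatℕ n stationary (Pℕ A n) (suc j)
  stationary-balance-suc = Equivalence.from (interior-balance⇔Recurrence A m stationary stationaryₙ≡0)
    (Recurrence-reverse (Recurrence-scale (xℚ-recurrence A n) normaliser))
    where
    stationaryₙ≡0 : stationary n ≡ 0ℚ
    stationaryₙ≡0 = trans (cong (λ k → xℚ A k * normaliser) (ℕP.n∸n≡0 n)) (QP.*-zeroˡ normaliser)

  stationary-nonNeg : ∀ i → 0ℚ Q.≤ stationary i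
  stationary-nonNeg i = QP.nonNegative⁻¹ (stationary i)
    {{QP.nonNeg*nonNeg⇒nonNeg (xℚ A (n ∸ i)) {{xℚ-nonNeg 2≤A (n ∸ i)}}
                              normaliser {{QP.pos⇒nonNeg normaliser {{normaliser-pos}}}}}}

  stationary-isSteadyState : IsSteadyState n (P A n) (stationary ∘ toℕ)
  stationary-isSteadyState =
    stationary-nonNeg ∘ toℕ ,
    trans (sumFin-xℚ-reversed A n normaliser) (QP.*-inverseʳ (fromℤ (sumX A n))) ,
    balance-from-suc (2 ℕ.+ m) (P A n) (P-rowStochastic A m) (stationary ∘ toℕ)
      (λ j → stationary-balance-suc (toℕ j) (s≤s (FP.toℕ<n j)))

  steadyState≡stationary : (π : Fin n → ℚ) → IsSteadyState n (P A n) π → ∀ i → π i ≡ stationary (toℕ i)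
  steadyState≡stationary π (_ , sum≡1 , balance) i = begin
    π i                       ≡⟨ extend-toℕ π i ⟨
    extend π (toℕ i)          ≡⟨ extend-form (toℕ i) (FP.toℕ<n i) ⟩
    xℚ A (n ∸ toℕ i) * w 1    ≡⟨ cong (xℚ A (n ∸ toℕ i) *_) w₁≡normaliser ⟩
    stationary (toℕ i)        ∎
    where
    open ≡-Reasoning
    w : ℕ → ℚ
    w k = extend π (n ∸ k)
    w-form : ∀ k → k ≤ n → w k ≡ xℚ A k * w 1
    w-form = Recurrence-unique
      (Recurrence-reverse (Equivalence.to (interior-balance⇔Recurrence A m (extend π) (extend-outside π))
                                          (λ j → extend-balance (Pℕ A n) π balance (suc j))))
      (extend-outside π)
    extend-form : ∀ k → k < n → extend π k ≡ xℚ A (n ∸ k) * w 1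
    extend-form k k<n =
      trans (cong (extend π) (sym (ℕP.m∸[m∸n]≡n (ℕP.<⇒≤ k<n)))) (w-form (n ∸ k) (ℕP.m∸n≤m n k))
    S = fromℤ (sumX A n)
    total : 1ℚ ≡ S * w 1
    total = begin
      1ℚ                                        ≡⟨ sum≡1 ⟨
      sumFin n π                                ≡⟨ sumFin-cong n (sym ∘ extend-toℕ π) ⟩
      sumFin n (extend π ∘ toℕ)                 ≡⟨ sumFin-cong n (λ i → extend-form (toℕ i) (FP.toℕ<n i)) ⟩
      sumFin n (λ i → xℚ A (n ∸ toℕ i) * w 1)    ≡⟨ sumFin-xℚ-reversed A n (w 1) ⟩
      S * w 1                                   ∎
    w₁≡normaliser : w 1 ≡ normaliser
    w₁≡normaliser = trans
      (Equivalence.from (transpose-by-inverse {S} {normaliser} (QP.*-inverseˡ S)) total)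
      (QP.*-identityˡ normaliser)

  πformula≡stationary : ∀ i → πformula A n i ≡ stationary (toℕ i)
  πformula≡stationary i = trans (/ℚ-fromℤ _ (sumX A n)) (cong (_* normaliser) (/1≡fromℤ (x A (n ∸ toℕ i))))

theorem5p1 : (A n : ℕ) → 2 < A → 3 ≤ n →
    IsSteadyState n (P A n) (πformula A n)
    × ((π : Fin n → ℚ) → IsSteadyState n (P A n) π → (i : Fin n) → π i ≡ πformula A n i)
theorem5p1 A (suc (suc (suc m))) 2<A (s≤s (s≤s (s≤s _))) =
  IsSteadyState-resp (P A (3 ℕ.+ m)) (sym ∘ πformula≡stationary A m 2≤A) (stationary-isSteadyState A m 2≤A) ,
  λ π steady i → trans (steadyState≡stationary A m 2≤A π steady i) (sym (πformula≡stationary A m 2≤A i))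
  where 2≤A = ℕP.<⇒≤ 2<A
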